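{- Let $p$ be a prime and $q$ a power of $p$. Then (1) $\tilde{\mathcal{G}}_q(x,y)\equiv(x^q,y^q)\pmod p$ and (2) $\mathcal{G}_q(x,y)\equiv(x^q,y^q)\pmod p$, where congruence means that each component of the difference is a polynomial in $\mathbf{Z}[x,y]$ with all coefficients divisible by $p$.
   Context: Define $\varPhi_{G_2}=(\varphi_1,\varphi_2):\mathbf{C}^2\to\mathbf{C}^2$ by $\varphi_1(\sigma,\tau)=e^{2\pi i\sigma}+e^{2\pi i\tau}+e^{2\pi i(\sigma+\tau)}+e^{ -2\pi i\sigma}+e^{ -2\pi i\tau}+e^{ -2\pi i(\sigma+\tau)}$ and $\varphi_2(\sigma,\tau)=e^{2\pi i(2\sigma+\tau)}+e^{2\pi i(\sigma+2\tau)}+e^{2\pi i(\sigma-\tau)}+e^{ -2\pi i(2\sigma+\tau)}+e^{ -2\pi i(\sigma+2\tau)}+e^{ -2\pi i(\sigma-\tau)}$. For each integer $k\ge0$, $\mathcal{G}_k:\mathbf{C}^2\to\mathbf{C}^2$ is the unique polynomial map (with integer coefficients) such that $\varPhi_{G_2}(k\sigma,k\tau)=\mathcal{G}_k(\varPhi_{G_2}(\sigma,\tau))$ for all $\sigma,\tau\in\mathbf{C}$ (the family associated with the Lie algebra $G_2$). Let $L(x,y)=(x,y-x)$ and $\tilde{\mathcal{G}}_k=L\circ\mathcal{G}_k\circ L^{ -1}$. -}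

module Defs where

open import Data.Nat as ℕ using (ℕ)
open import Data.Integer as ℤ using (ℤ; +_; -[1+_])
open import Data.Integer.Divisibility using (_∣_)
open import Data.Nat.Primality using (Prime)
open import Data.List using (List; []; _∷_; _++_; map; concatMap; foldr)
open import Data.Product using (_×_; _,_)
open import Relation.Binary.Definitions using (DecidableEquality)
open import Relation.Binary.PropositionalEquality using (_≡_)
open import Relation.Nullary using (yes; no)

-- Finite formal sums of monomials  c · x^a · y^b  with coefficients in ℤ,
-- exponents in E (E = ℕ: polynomials Z[x,y]; E = ℤ: Laurent polynomials
-- Z[u^±1, v^±1]).  A list may repeat a monomial; the actual polynomial is
-- determined by the coefficient function 'coeff' (which collects terms).
module Terms (E : Set) (_⊕_ : E → E → E) (e₀ : E) (_≟E_ : DecidableEquality E) where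

  T : Set
  T = List (ℤ × E × E)

  const : ℤ → T
  const c = (c , e₀ , e₀) ∷ []

  _⊞_ : T → T → T
  P ⊞ Q = P ++ Q

  neg : T → T
  neg = map (λ { (c , a , b) → (ℤ.- c , a , b) })

  _⊟_ : T → T → T
  P ⊟ Q = P ⊞ neg Q

  _⊠_ : T → T → T
  P ⊠ Q = concatMap (λ { (c , a , b) → map (λ { (d , a' , b') → (c ℤ.* d , a ⊕ a' , b ⊕ b') }) Q }) P

  pow : T → ℕ → T
  pow P ℕ.zero = const (+ 1)
  pow P (ℕ.suc n) = P ⊠ pow P n

  coeff : T → E → E → ℤ
  coeff [] a b = + 0
  coeff ((c , a' , b') ∷ P) a b with a' ≟E a | b' ≟E b
  ... | yes _ | yes _ = c ℤ.+ coeff P a b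
  ... | _     | _     = coeff P a b

  eval : List (ℤ × ℕ × ℕ) → T → T → T
  eval P f g = foldr (λ { (c , i , j) acc → ((const c ⊠ pow f i) ⊠ pow g j) ⊞ acc }) [] P

  _≐_ : T → T → Set
  P ≐ Q = ∀ a b → coeff P a b ≡ coeff Q a b

module Poly = Terms ℕ ℕ._+_ 0 ℕ._≟_
module Laurent = Terms ℤ ℤ._+_ (+ 0) ℤ._≟_

Poly : Set
Poly = Poly.T

X Y : Poly
X = (+ 1 , 1 , 0) ∷ []
Y = (+ 1 , 0 , 1) ∷ []

-- Laurent polynomials in u = e^{2πiσ}, v = e^{2πiτ}
LPoly : Set
LPoly = Laurent.T

-1ℤ -2ℤ : ℤ
-1ℤ = -[1+ 0 ]
-2ℤ = -[1+ 1 ]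

φ₁ : LPoly
φ₁ = (+ 1 , + 1 , + 0) ∷ (+ 1 , + 0 , + 1) ∷ (+ 1 , + 1 , + 1)
   ∷ (+ 1 , -1ℤ , + 0) ∷ (+ 1 , + 0 , -1ℤ) ∷ (+ 1 , -1ℤ , -1ℤ) ∷ []

φ₂ : LPoly
φ₂ = (+ 1 , + 2 , + 1) ∷ (+ 1 , + 1 , + 2) ∷ (+ 1 , + 1 , -1ℤ)
   ∷ (+ 1 , -2ℤ , -1ℤ) ∷ (+ 1 , -1ℤ , -2ℤ) ∷ (+ 1 , -1ℤ , + 1) ∷ []

-- f(u,v) ↦ f(u^k, v^k)   (i.e. (σ,τ) ↦ (kσ,kτ))
dilate : ℕ → LPoly → LPoly
dilate k = map (λ { (c , a , b) → (c , (+ k) ℤ.* a , (+ k) ℤ.* b) })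

-- (G₁, G₂) is the polynomial map 𝒢_k:  Φ(kσ,kτ) = 𝒢_k(Φ(σ,τ)),
-- expressed as an identity of Laurent polynomials in u, v.
IsG : ℕ → Poly → Poly → Set
IsG k G₁ G₂ =
  Laurent._≐_ (Laurent.eval G₁ φ₁ φ₂) (dilate k φ₁) ×
  Laurent._≐_ (Laurent.eval G₂ φ₁ φ₂) (dilate k φ₂)

-- components of  L ∘ (G₁,G₂) ∘ L⁻¹,  L(x,y) = (x, y - x),  L⁻¹(x,y) = (x, x + y)
tilde₁ : Poly → Poly → Poly
tilde₁ G₁ G₂ = Poly.eval G₁ X (Poly._⊞_ X Y)

tilde₂ : Poly → Poly → Poly
tilde₂ G₁ G₂ = Poly._⊟_ (Poly.eval G₂ X (Poly._⊞_ X Y)) (Poly.eval G₁ X (Poly._⊞_ X Y))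

CongMod : ℕ → Poly → Poly → Set
CongMod p P Q = ∀ i j → (+ p) ∣ Poly.coeff (Poly._⊟_ P Q) i j

-- Modulo p, q-th powers with q = p^n are additive (Frobenius), so a Laurent
-- polynomial φ whose coefficients are all 1 satisfies φ^q ≡ φ(u^q, v^q).  Hence
-- G₁(φ₁, φ₂) = φ₁(u^q, v^q) ≡ φ₁^q and G₂(φ₁, φ₂) ≡ φ₂^q.  But φ₁, φ₂ stay
-- algebraically independent modulo p: for the weight 2a + 3b of u^a v^b, the product
-- φ₁^i φ₂^j has the unique heaviest monomial u^(i+j) v^(i+2j), with coefficient 1,
-- and distinct (i, j) give distinct such monomials; so if K(φ₁, φ₂) ≡ 0 then all
-- coefficients of K are ≡ 0, by downward induction on the weight 5i + 8j.  This is
-- (2), and (1) follows by substituting (x, x + y) and using (x + y)^q ≡ x^q + y^q.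

module Submission where

open import Defs
open import Algebra.Bundles using (CommutativeSemiring)
open import Algebra.Definitions using (LeftCancellative)
open import Algebra.Structures using (IsCommutativeMonoid; IsCommutativeSemiring)
import Algebra.Structures.Biased as Biased
open import Data.Fin using (zero; suc; fromℕ; inject₁)
import Data.Fin.Properties as FinP
open import Data.Integer as ℤ using (ℤ; +_; _+_; _*_; -_; _-_)
open import Data.Integer.Divisibility.Signed
  using (_∣_; divides; ∣⇒∣ᵤ; ∣ᵤ⇒∣; ∣m⇒∣-m; ∣m∣n⇒∣m+n; ∣n⇒∣m*n; ∣m⇒∣m*n)
import Data.Integer.Properties as ℤP
open import Algebra.Properties.AbelianGroup ℤP.+-0-abelianGroup using () renaming (∙-cancelˡ to ℤ-+-cancelˡ)
open import Data.Integer.Tactic.RingSolver using (solve-∀)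
open import Data.List using ([]; _∷_; _++_; map)
import Data.List.Properties as ListP
open import Data.List.Relation.Unary.All as All using (All; []; _∷_)
import Data.List.Relation.Unary.All.Properties as AllP
open import Data.Nat as ℕ using (ℕ; zero; suc; _∸_; _^_; _!; z≤n; s≤s)
open import Data.Nat.Combinatorics using (_C_; nCn≡1; nCk≡n!/k![n-k]!; k![n∸k]!∣n!)
open import Data.Nat.Divisibility as ℕD using () renaming (_∣_ to _∣ℕ_; _∤_ to _∤ℕ_)
open import Data.Nat.DivMod using (m/n*n≡m)
open import Data.Nat.Primality using (Prime; euclidsLemma; prime⇒nonZero; ¬prime[0]; ¬prime[1])
import Data.Nat.Properties as ℕP
open import Data.Product using (∃; _×_; _,_; proj₁; proj₂)
open import Data.Sum using (_⊎_; inj₁; inj₂)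
open import Data.Vec.Functional using (tail; init; last; replicate)
open import Function using (_∘_; _$_)
open import Level using (0ℓ)
open import Relation.Binary.Definitions using (DecidableEquality)
open import Relation.Binary.Structures using (IsEquivalence)
open import Relation.Binary.PropositionalEquality hiding (setoid; [_])
open import Relation.Nullary using (¬_; Dec; yes; no; contradiction)
open import Relation.Nullary.Decidable using (True; toWitness; _×-dec_)

infix 4 _≡_[mod_]
record _≡_[mod_] (x y : ℤ) (m : ℕ) : Set where
  constructor mk≡mod
  field difference-divisible : (+ m) ∣ (x - y)
open _≡_[mod_] public

module _ {m : ℕ} where

  private
    ∣-resp : ∀ {x y} → x ≡ y → (+ m) ∣ x → (+ m) ∣ y
    ∣-resp = subst ((+ m) ∣_)

  ≡⇒≡-mod : ∀ {x y} → x ≡ y → x ≡ y [mod m ]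
  ≡⇒≡-mod {x} refl = mk≡mod (divides (+ 0) (ℤP.+-inverseʳ x))

  ≡-mod-refl : ∀ {x} → x ≡ x [mod m ]
  ≡-mod-refl = ≡⇒≡-mod refl

  ≡-mod-sym : ∀ {x y} → x ≡ y [mod m ] → y ≡ x [mod m ]
  ≡-mod-sym {x} {y} (mk≡mod d) = mk≡mod (∣-resp (identity x y) (∣m⇒∣-m d))
    where identity : ∀ x y → - (x - y) ≡ y - x
          identity = solve-∀

  ≡-mod-trans : ∀ {x y z} → x ≡ y [mod m ] → y ≡ z [mod m ] → x ≡ z [mod m ]
  ≡-mod-trans {x} {y} {z} (mk≡mod d) (mk≡mod d') = mk≡mod (∣-resp (identity x y z) (∣m∣n⇒∣m+n d d'))
    where identity : ∀ x y z → (x - y) + (y - z) ≡ x - z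
          identity = solve-∀

  +-cong-mod : ∀ {x y u v} → x ≡ y [mod m ] → u ≡ v [mod m ] → x + u ≡ y + v [mod m ]
  +-cong-mod {x} {y} {u} {v} (mk≡mod d) (mk≡mod d') = mk≡mod (∣-resp (identity x y u v) (∣m∣n⇒∣m+n d d'))
    where identity : ∀ x y u v → (x - y) + (u - v) ≡ (x + u) - (y + v)
          identity = solve-∀

  neg-cong-mod : ∀ {x y} → x ≡ y [mod m ] → - x ≡ - y [mod m ]
  neg-cong-mod {x} {y} (mk≡mod d) = mk≡mod (∣-resp (identity x y) (∣m⇒∣-m d))
    where identity : ∀ x y → - (x - y) ≡ (- x) - (- y)
          identity = solve-∀

  *-congˡ-mod : ∀ c {x y} → x ≡ y [mod m ] → c * x ≡ c * y [mod m ]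
  *-congˡ-mod c {x} {y} (mk≡mod d) = mk≡mod (∣-resp (identity c x y) (∣n⇒∣m*n c d))
    where identity : ∀ c x y → c * (x - y) ≡ c * x - c * y
          identity = solve-∀

  *-congʳ-mod : ∀ c {x y} → x ≡ y [mod m ] → x * c ≡ y * c [mod m ]
  *-congʳ-mod c {x} {y} (mk≡mod d) = mk≡mod (∣-resp (identity c x y) (∣m⇒∣m*n c d))
    where identity : ∀ c x y → (x - y) * c ≡ x * c - y * c
          identity = solve-∀

  ∣⇒≡0-mod : ∀ {x} → (+ m) ∣ x → x ≡ + 0 [mod m ]
  ∣⇒≡0-mod {x} d = mk≡mod (∣-resp (sym (ℤP.+-identityʳ x)) d)

  ≡0-mod⇒∣ : ∀ {x} → x ≡ + 0 [mod m ] → (+ m) ∣ x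
  ≡0-mod⇒∣ {x} (mk≡mod d) = ∣-resp (ℤP.+-identityʳ x) d

  ∣0 : (+ m) ∣ + 0
  ∣0 = divides (+ 0) refl

prime∤! : ∀ {p} → Prime p → ∀ k → k ℕ.< p → p ∤ℕ k !
prime∤! pr zero _ p∣1 = ¬prime[1] (subst Prime (ℕD.∣1⇒≡1 p∣1) pr)
prime∤! pr (suc k) 1+k<p p∣[1+k]! with euclidsLemma (suc k) (k !) pr p∣[1+k]!
... | inj₁ p∣1+k = ℕP.<⇒≱ 1+k<p (ℕD.∣⇒≤ p∣1+k)
... | inj₂ p∣k!  = prime∤! pr k (ℕP.<-trans (ℕP.n<1+n k) 1+k<p) p∣k!

C*k!*[n∸k]!≡n! : ∀ {n k} → k ℕ.≤ n → (n C k) ℕ.* (k ! ℕ.* (n ∸ k) !) ≡ n !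
C*k!*[n∸k]!≡n! {n} {k} k≤n =
  trans (cong (ℕ._* (k ! ℕ.* (n ∸ k) !)) (nCk≡n!/k![n-k]! k≤n))
        (m/n*n≡m {{k ℕP.!* (n ∸ k) !≢0}} (k![n∸k]!∣n! k≤n))

prime∣C : ∀ {p k} → Prime p → 0 ℕ.< k → k ℕ.< p → p ∣ℕ p C k
prime∣C {zero} pr = contradiction pr ¬prime[0]
prime∣C {p@(suc p-1)} {k} pr 0<k k<p
  with euclidsLemma (p C k) (k ! ℕ.* (p ∸ k) !) pr
         (subst (p ∣ℕ_) (sym (C*k!*[n∸k]!≡n! (ℕP.<⇒≤ k<p))) (ℕD.m∣m*n (p-1 !)))
... | inj₁ p∣C = p∣C
... | inj₂ p∣k!*[p∸k]! with euclidsLemma (k !) ((p ∸ k) !) pr p∣k!*[p∸k]!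
...   | inj₁ p∣k!     = contradiction p∣k! (prime∤! pr k k<p)
...   | inj₂ p∣[p∸k]! = contradiction p∣[p∸k]! (prime∤! pr (p ∸ k) (ℕP.∸-monoʳ-< 0<k (ℕP.<⇒≤ k<p)))

module Frobenius {c ℓ} (S : CommutativeSemiring c ℓ) where
  open CommutativeSemiring S
    renaming (_+_ to _+ₛ_; _*_ to _*ₛ_; refl to ≈-refl; sym to ≈-sym; trans to ≈-trans; zero to *-zero)
  open import Algebra.Properties.CommutativeSemiring.Binomial S using (theorem; binomialTerm)
  open import Algebra.Properties.Semiring.Exp semiring using (^-congˡ; ^-congʳ; ^-assocʳ) renaming (_^_ to _^ₛ_)
  open import Algebra.Properties.Semiring.Mult semiring using (×-cong) renaming (_×_ to _×ₛ_)
  open import Algebra.Properties.Semiring.Sum semiring using (sum; sum-init-last; sum-cong-≋; sum-replicate-zero)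
  open import Relation.Binary.Reasoning.Setoid setoid

  freshmans-dream : ∀ n x y → (∀ k → 0 ℕ.< k → k ℕ.< suc n → ∀ z → (suc n C k) ×ₛ z ≈ 0#) →
                    (x +ₛ y) ^ₛ suc n ≈ x ^ₛ suc n +ₛ y ^ₛ suc n
  freshmans-dream n x y middle-vanishes = begin
    (x +ₛ y) ^ₛ suc n                                  ≈⟨ theorem (suc n) x y ⟩
    t zero +ₛ sum (tail t)                             ≈⟨ +-cong first (sum-init-last (tail t)) ⟩
    y ^ₛ suc n +ₛ (sum (init (tail t)) +ₛ last t)      ≈⟨ +-congˡ (+-cong (sum-cong-≋ middle) final) ⟩
    y ^ₛ suc n +ₛ (sum (replicate n 0#) +ₛ x ^ₛ suc n) ≈⟨ +-congˡ (+-congʳ (sum-replicate-zero n)) ⟩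
    y ^ₛ suc n +ₛ (0# +ₛ x ^ₛ suc n)                   ≈⟨ +-congˡ (+-identityˡ _) ⟩
    y ^ₛ suc n +ₛ x ^ₛ suc n                           ≈⟨ +-comm _ _ ⟩
    x ^ₛ suc n +ₛ y ^ₛ suc n                           ∎
    where
      t = binomialTerm x y (suc n)

      first : t zero ≈ y ^ₛ suc n
      first = ≈-trans (+-identityʳ _) (*-identityˡ _)

      middle : ∀ i → t (suc (inject₁ i)) ≈ 0#
      middle i = middle-vanishes _ (s≤s z≤n)
        (s≤s (subst (ℕ._< n) (sym (FinP.toℕ-inject₁ i)) (FinP.toℕ<n i))) _

      top : ∀ k → k ≡ suc n → (suc n C k) ×ₛ (x ^ₛ k *ₛ y ^ₛ (suc n ∸ k)) ≈ x ^ₛ suc n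
      top _ refl = ≈-trans (×-cong (nCn≡1 (suc n)) (*-congˡ (^-congʳ y (ℕP.n∸n≡0 (suc n)))))
                           (≈-trans (+-identityʳ _) (*-identityʳ _))

      final : t (fromℕ (suc n)) ≈ x ^ₛ suc n
      final = top _ (FinP.toℕ-fromℕ (suc n))

  CharDivides : ℕ → Set (c Level.⊔ ℓ)
  CharDivides p = ∀ k z → p ∣ℕ k → k ×ₛ z ≈ 0#

  frobenius : ∀ {p} → Prime p → CharDivides p → ∀ x y → (x +ₛ y) ^ₛ p ≈ x ^ₛ p +ₛ y ^ₛ p
  frobenius {zero} pr = contradiction pr ¬prime[0]
  frobenius {suc p-1} pr char x y =
    freshmans-dream p-1 x y (λ k 0<k k<p z → char _ z (prime∣C pr 0<k k<p))

  frobenius-^ : ∀ {p} → Prime p → CharDivides p → ∀ n x y →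
                (x +ₛ y) ^ₛ (p ^ n) ≈ x ^ₛ (p ^ n) +ₛ y ^ₛ (p ^ n)
  frobenius-^ pr char zero x y =
    ≈-trans (*-identityʳ _) (+-cong (≈-sym (*-identityʳ x)) (≈-sym (*-identityʳ y)))
  frobenius-^ {p} pr char (suc n) x y = begin
    (x +ₛ y) ^ₛ (p ℕ.* q)            ≈⟨ ^-p*q (x +ₛ y) ⟩
    ((x +ₛ y) ^ₛ q) ^ₛ p             ≈⟨ ^-congˡ p (frobenius-^ pr char n x y) ⟩
    (x ^ₛ q +ₛ y ^ₛ q) ^ₛ p          ≈⟨ frobenius pr char _ _ ⟩
    (x ^ₛ q) ^ₛ p +ₛ (y ^ₛ q) ^ₛ p   ≈⟨ +-cong (≈-sym (^-p*q x)) (≈-sym (^-p*q y)) ⟩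
    x ^ₛ (p ℕ.* q) +ₛ y ^ₛ (p ℕ.* q) ∎
    where
      q = p ^ n
      ^-p*q : ∀ z → z ^ₛ (p ℕ.* q) ≈ (z ^ₛ q) ^ₛ p
      ^-p*q z = ≈-trans (^-congʳ z (ℕP.*-comm p q)) (≈-sym (^-assocʳ z q p))

sumBelow : ℕ → (ℕ → ℤ) → ℤ
sumBelow zero    f = + 0
sumBelow (suc n) f = f n + sumBelow n f

sumBelow-cong : ∀ n {f g} → (∀ i → i ℕ.< n → f i ≡ g i) → sumBelow n f ≡ sumBelow n g
sumBelow-cong zero    f≡g = refl
sumBelow-cong (suc n) f≡g = cong₂ _+_ (f≡g n ℕP.≤-refl) (sumBelow-cong n (λ i i<n → f≡g i (ℕP.m<n⇒m<1+n i<n)))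

sumBelow-cong-mod : ∀ {m} n {f g} → (∀ i → i ℕ.< n → f i ≡ g i [mod m ]) →
                    sumBelow n f ≡ sumBelow n g [mod m ]
sumBelow-cong-mod zero    f≡g = ≡-mod-refl
sumBelow-cong-mod (suc n) f≡g =
  +-cong-mod (f≡g n ℕP.≤-refl) (sumBelow-cong-mod n (λ i i<n → f≡g i (ℕP.m<n⇒m<1+n i<n)))

sumBelow-+ : ∀ n f g → sumBelow n (λ i → f i + g i) ≡ sumBelow n f + sumBelow n g
sumBelow-+ zero    f g = refl
sumBelow-+ (suc n) f g =
  trans (cong (λ z → (f n + g n) + z) (sumBelow-+ n f g)) (interchange (f n) (g n) (sumBelow n f) (sumBelow n g))
  where interchange : ∀ a b c d → (a + b) + (c + d) ≡ (a + c) + (b + d)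
        interchange = solve-∀

sumBelow-zero : ∀ n {f} → (∀ i → i ℕ.< n → f i ≡ + 0) → sumBelow n f ≡ + 0
sumBelow-zero zero    f≡0 = refl
sumBelow-zero (suc n) f≡0 = cong₂ _+_ (f≡0 n ℕP.≤-refl) (sumBelow-zero n (λ i i<n → f≡0 i (ℕP.m<n⇒m<1+n i<n)))

sumBelow-single : ∀ n {f} i₀ → i₀ ℕ.< n → (∀ i → i ℕ.< n → i ≢ i₀ → f i ≡ + 0) → sumBelow n f ≡ f i₀
sumBelow-single (suc n) {f} i₀ i₀<1+n f≡0 with n ℕ.≟ i₀
... | yes refl = trans (cong (λ z → f n + z) (sumBelow-zero n (λ i i<n → f≡0 i (ℕP.m<n⇒m<1+n i<n) (ℕP.<⇒≢ i<n))))
                       (ℤP.+-identityʳ (f n))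
... | no n≢i₀  = trans (cong₂ _+_ (f≡0 n ℕP.≤-refl n≢i₀)
                                   (sumBelow-single n i₀ (ℕP.≤∧≢⇒< (ℕP.≤-pred i₀<1+n) (n≢i₀ ∘ sym))
                                                    (λ i i<n → f≡0 i (ℕP.m<n⇒m<1+n i<n))))
                       (ℤP.+-identityˡ (f i₀))

sumBelow² : ℕ → (ℕ → ℕ → ℤ) → ℤ
sumBelow² N F = sumBelow N (λ i → sumBelow N (F i))

sumBelow²-cong : ∀ N {F G} → (∀ i j → i ℕ.< N → j ℕ.< N → F i j ≡ G i j) → sumBelow² N F ≡ sumBelow² N G
sumBelow²-cong N F≡G = sumBelow-cong N (λ i i<N → sumBelow-cong N (λ j j<N → F≡G i j i<N j<N))

sumBelow²-cong-mod : ∀ {m} N {F G} → (∀ i j → i ℕ.< N → j ℕ.< N → F i j ≡ G i j [mod m ]) →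
                     sumBelow² N F ≡ sumBelow² N G [mod m ]
sumBelow²-cong-mod N F≡G = sumBelow-cong-mod N (λ i i<N → sumBelow-cong-mod N (λ j j<N → F≡G i j i<N j<N))

sumBelow²-+ : ∀ N F G → sumBelow² N (λ i j → F i j + G i j) ≡ sumBelow² N F + sumBelow² N G
sumBelow²-+ N F G = trans (sumBelow-cong N (λ i _ → sumBelow-+ N (F i) (G i)))
                          (sumBelow-+ N (λ i → sumBelow N (F i)) (λ i → sumBelow N (G i)))

sumBelow²-zero : ∀ N {F} → (∀ i j → i ℕ.< N → j ℕ.< N → F i j ≡ + 0) → sumBelow² N F ≡ + 0
sumBelow²-zero N F≡0 = sumBelow-zero N (λ i i<N → sumBelow-zero N (λ j j<N → F≡0 i j i<N j<N))

sumBelow²-single : ∀ N {F} i₀ j₀ → i₀ ℕ.< N → j₀ ℕ.< N →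
                   (∀ i j → i ℕ.< N → j ℕ.< N → ¬ (i ≡ i₀ × j ≡ j₀) → F i j ≡ + 0) →
                   sumBelow² N F ≡ F i₀ j₀
sumBelow²-single N i₀ j₀ i₀<N j₀<N F≡0 =
  trans (sumBelow-single N i₀ i₀<N (λ i i<N i≢i₀ → sumBelow-zero N (λ j j<N → F≡0 i j i<N j<N (i≢i₀ ∘ proj₁))))
        (sumBelow-single N j₀ j₀<N (λ j j<N j≢j₀ → F≡0 i₀ j i₀<N j<N (j≢j₀ ∘ proj₂)))

module Coefficients (E : Set) (_⊕_ : E → E → E) (e₀ : E) (_≟E_ : DecidableEquality E) where
  open Terms E _⊕_ e₀ _≟E_ public

  Term : Set
  Term = ℤ × E × E

  coeff₁ : Term → E → E → ℤ
  coeff₁ t = coeff (t ∷ [])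

  Avoids : E → E → Term → Set
  Avoids a b (_ , a' , b') = ¬ (a' ≡ a × b' ≡ b)

  coeff-∷ : ∀ t P a b → coeff (t ∷ P) a b ≡ coeff₁ t a b + coeff P a b
  coeff-∷ (c , a' , b') P a b with a' ≟E a | b' ≟E b
  ... | yes _ | yes _ = cong (_+ coeff P a b) (sym (ℤP.+-identityʳ c))
  ... | yes _ | no _  = sym (ℤP.+-identityˡ _)
  ... | no _  | _     = sym (ℤP.+-identityˡ _)

  coeff₁-≡ : ∀ c a b → coeff₁ (c , a , b) a b ≡ c
  coeff₁-≡ c a b with a ≟E a | b ≟E b
  ... | yes _  | yes _  = ℤP.+-identityʳ c
  ... | yes _  | no b≢b = contradiction refl b≢b
  ... | no a≢a | _      = contradiction refl a≢a

  coeff₁-avoids : ∀ {a b} t → Avoids a b t → coeff₁ t a b ≡ + 0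
  coeff₁-avoids {a} {b} (c , a' , b') avoids with a' ≟E a | b' ≟E b
  ... | yes a'≡a | yes b'≡b = contradiction (a'≡a , b'≡b) avoids
  ... | yes _    | no _     = refl
  ... | no _     | _        = refl

  coeff-avoids : ∀ {a b} P → All (Avoids a b) P → coeff P a b ≡ + 0
  coeff-avoids []      []                   = refl
  coeff-avoids (t ∷ P) (t-avoids ∷ avoids) =
    trans (coeff-∷ t P _ _) (cong₂ _+_ (coeff₁-avoids t t-avoids) (coeff-avoids P avoids))

  coeff-++ : ∀ P Q a b → coeff (P ++ Q) a b ≡ coeff P a b + coeff Q a b
  coeff-++ []      Q a b = sym (ℤP.+-identityˡ _)
  coeff-++ (t ∷ P) Q a b = begin
    coeff (t ∷ (P ++ Q)) a b                 ≡⟨ coeff-∷ t (P ++ Q) a b ⟩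
    coeff₁ t a b + coeff (P ++ Q) a b        ≡⟨ cong (λ z → coeff₁ t a b + z) (coeff-++ P Q a b) ⟩
    coeff₁ t a b + (coeff P a b + coeff Q a b) ≡⟨ ℤP.+-assoc (coeff₁ t a b) _ _ ⟨
    (coeff₁ t a b + coeff P a b) + coeff Q a b ≡⟨ cong (_+ coeff Q a b) (coeff-∷ t P a b) ⟨
    coeff (t ∷ P) a b + coeff Q a b          ∎
    where open ≡-Reasoning

  coeff-map : ∀ (f : Term → Term) (h : ℤ → ℤ) → h (+ 0) ≡ + 0 → (∀ x y → h (x + y) ≡ h x + h y) →
              ∀ {a b a' b'} → (∀ t → coeff₁ (f t) a b ≡ h (coeff₁ t a' b')) →
              ∀ P → coeff (map f P) a b ≡ h (coeff P a' b')
  coeff-map f h h-0 h-+ f-coeff₁ [] = sym h-0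
  coeff-map f h h-0 h-+ {a} {b} {a'} {b'} f-coeff₁ (t ∷ P) = begin
    coeff (f t ∷ map f P) a b                       ≡⟨ coeff-∷ (f t) (map f P) a b ⟩
    coeff₁ (f t) a b + coeff (map f P) a b          ≡⟨ cong₂ _+_ (f-coeff₁ t) (coeff-map f h h-0 h-+ f-coeff₁ P) ⟩
    h (coeff₁ t a' b') + h (coeff P a' b')          ≡⟨ h-+ _ _ ⟨
    h (coeff₁ t a' b' + coeff P a' b')              ≡⟨ cong h (coeff-∷ t P a' b') ⟨
    h (coeff (t ∷ P) a' b')                         ∎
    where open ≡-Reasoning

  coeff₁-neg : ∀ c a' b' a b → coeff₁ (- c , a' , b') a b ≡ - coeff₁ (c , a' , b') a b
  coeff₁-neg c a' b' a b with a' ≟E a | b' ≟E b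
  ... | yes _ | yes _ = trans (ℤP.+-identityʳ _) (cong -_ (sym (ℤP.+-identityʳ c)))
  ... | yes _ | no _  = refl
  ... | no _  | _     = refl

  coeff-neg : ∀ P a b → coeff (neg P) a b ≡ - coeff P a b
  coeff-neg P a b = coeff-map _ -_ refl ℤP.neg-distrib-+ (λ { (c , a' , b') → coeff₁-neg c a' b' a b }) P

  coeff-⊟ : ∀ P Q a b → coeff (P ⊟ Q) a b ≡ coeff P a b - coeff Q a b
  coeff-⊟ P Q a b = trans (coeff-++ P (neg Q) a b) (cong (λ z → coeff P a b + z) (coeff-neg Q a b))

  P⊞Q⊟P≐Q : ∀ P Q → ((P ⊞ Q) ⊟ P) ≐ Q
  P⊞Q⊟P≐Q P Q a b = begin
    coeff ((P ⊞ Q) ⊟ P) a b                       ≡⟨ coeff-⊟ (P ⊞ Q) P a b ⟩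
    coeff (P ⊞ Q) a b - coeff P a b               ≡⟨ cong (_- coeff P a b) (coeff-++ P Q a b) ⟩
    (coeff P a b + coeff Q a b) - coeff P a b     ≡⟨ identity (coeff P a b) (coeff Q a b) ⟩
    coeff Q a b                                   ∎
    where
      open ≡-Reasoning
      identity : ∀ x y → (x + y) - x ≡ y
      identity = solve-∀

  infix 4 _≈_[mod_]
  record _≈_[mod_] (P Q : T) (m : ℕ) : Set where
    constructor mk≈mod
    field coeff-≡-mod : ∀ a b → coeff P a b ≡ coeff Q a b [mod m ]
  open _≈_[mod_] public

  module _ {m : ℕ} where

    ≐⇒≈-mod : ∀ {P Q} → P ≐ Q → P ≈ Q [mod m ]
    ≐⇒≈-mod P≐Q = mk≈mod λ a b → ≡⇒≡-mod (P≐Q a b)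

    ≡⇒≈-mod : ∀ {P Q} → P ≡ Q → P ≈ Q [mod m ]
    ≡⇒≈-mod refl = ≐⇒≈-mod λ _ _ → refl

    ≈-mod-refl : ∀ {P} → P ≈ P [mod m ]
    ≈-mod-refl = ≡⇒≈-mod refl

    ≈-mod-sym : ∀ {P Q} → P ≈ Q [mod m ] → Q ≈ P [mod m ]
    ≈-mod-sym P≈Q = mk≈mod λ a b → ≡-mod-sym (coeff-≡-mod P≈Q a b)

    ≈-mod-trans : ∀ {P Q R} → P ≈ Q [mod m ] → Q ≈ R [mod m ] → P ≈ R [mod m ]
    ≈-mod-trans P≈Q Q≈R = mk≈mod λ a b → ≡-mod-trans (coeff-≡-mod P≈Q a b) (coeff-≡-mod Q≈R a b)

    ⊞-cong-mod : ∀ {P P' Q Q'} → P ≈ P' [mod m ] → Q ≈ Q' [mod m ] → P ⊞ Q ≈ P' ⊞ Q' [mod m ]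
    ⊞-cong-mod {P} {P'} {Q} {Q'} P≈P' Q≈Q' = mk≈mod λ a b →
      subst₂ _≡_[mod m ] (sym (coeff-++ P Q a b)) (sym (coeff-++ P' Q' a b))
             (+-cong-mod (coeff-≡-mod P≈P' a b) (coeff-≡-mod Q≈Q' a b))

    ⊟-cong-mod : ∀ {P P' Q Q'} → P ≈ P' [mod m ] → Q ≈ Q' [mod m ] → P ⊟ Q ≈ P' ⊟ Q' [mod m ]
    ⊟-cong-mod {P} {P'} {Q} {Q'} P≈P' Q≈Q' = mk≈mod λ a b →
      subst₂ _≡_[mod m ] (sym (coeff-⊟ P Q a b)) (sym (coeff-⊟ P' Q' a b))
             (+-cong-mod (coeff-≡-mod P≈P' a b) (neg-cong-mod (coeff-≡-mod Q≈Q' a b)))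

module PolyCoeff = Coefficients ℕ ℕ._+_ 0 ℕ._≟_

module _ where
  open PolyCoeff using (_≈_[mod_]; coeff-≡-mod; coeff; coeff₁; coeff-∷; coeff₁-≡; coeff₁-avoids; coeff-⊟)

  ≈⇒CongMod : ∀ {m P Q} → P ≈ Q [mod m ] → CongMod m P Q
  ≈⇒CongMod {m} {P} {Q} P≈Q i j =
    ∣⇒∣ᵤ (subst ((+ m) ∣_) (sym (coeff-⊟ P Q i j)) (difference-divisible (coeff-≡-mod P≈Q i j)))

  pow-X : ∀ k → Poly.pow X k ≡ (+ 1 , k , 0) ∷ []
  pow-X zero    = refl
  pow-X (suc k) rewrite pow-X k = refl

  pow-Y : ∀ k → Poly.pow Y k ≡ (+ 1 , 0 , k) ∷ []
  pow-Y zero    = refl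
  pow-Y (suc k) rewrite pow-Y k = refl

  InBox : ℕ → ℤ × ℕ × ℕ → Set
  InBox N (_ , i , j) = i ℕ.< N × j ℕ.< N

  Bounded : ℕ → Poly → Set
  Bounded N = All (InBox N)

  bounded-mono : ∀ {N N'} → N ℕ.≤ N' → ∀ {K} → Bounded N K → Bounded N' K
  bounded-mono N≤N' = All.map (λ (i<N , j<N) → ℕP.<-≤-trans i<N N≤N' , ℕP.<-≤-trans j<N N≤N')

  bounded : ∀ K → ∃ λ N → Bounded N K
  bounded [] = 0 , []
  bounded ((_ , i , j) ∷ K) with bounded K
  ... | N , K<N = M , (i<M , j<M) ∷ bounded-mono N≤M K<N
    where
      M = suc (i ℕ.+ j ℕ.+ N)
      i<M : i ℕ.< M
      i<M = s≤s (ℕP.≤-trans (ℕP.m≤m+n i j) (ℕP.m≤m+n (i ℕ.+ j) N))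
      j<M : j ℕ.< M
      j<M = s≤s (ℕP.≤-trans (ℕP.m≤n+m j i) (ℕP.m≤m+n (i ℕ.+ j) N))
      N≤M : N ℕ.≤ M
      N≤M = ℕP.≤-trans (ℕP.m≤n+m N (i ℕ.+ j)) (ℕP.n≤1+n _)

  ⟪_,_⟫ : Poly → (ℕ → ℕ → ℤ) → ℤ
  ⟪ []              , w ⟫ = + 0
  ⟪ (c , i , j) ∷ K , w ⟫ = c * w i j + ⟪ K , w ⟫

  pairing-++ : ∀ K K' w → ⟪ K ++ K' , w ⟫ ≡ ⟪ K , w ⟫ + ⟪ K' , w ⟫
  pairing-++ []              K' w = sym (ℤP.+-identityˡ _)
  pairing-++ ((c , i , j) ∷ K) K' w =
    trans (cong (λ z → c * w i j + z) (pairing-++ K K' w)) (sym (ℤP.+-assoc (c * w i j) _ _))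

  pairing-neg : ∀ K w → ⟪ Poly.neg K , w ⟫ ≡ - ⟪ K , w ⟫
  pairing-neg []                w = refl
  pairing-neg ((c , i , j) ∷ K) w =
    trans (cong₂ _+_ (sym (ℤP.neg-distribˡ-* c (w i j))) (pairing-neg K w))
          (sym (ℤP.neg-distrib-+ (c * w i j) ⟪ K , w ⟫))

  pairing-⊟ : ∀ K K' w → ⟪ Poly._⊟_ K K' , w ⟫ ≡ ⟪ K , w ⟫ - ⟪ K' , w ⟫
  pairing-⊟ K K' w = trans (pairing-++ K (Poly.neg K') w) (cong (λ z → ⟪ K , w ⟫ + z) (pairing-neg K' w))

  -- A term list may repeat monomials; summing over a box of exponents instead shows
  -- that the pairing depends on K only through its coefficients.
  pairing-as-sum : ∀ N w K → Bounded N K → ⟪ K , w ⟫ ≡ sumBelow² N (λ i j → coeff K i j * w i j)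
  pairing-as-sum N w [] [] = sym (sumBelow²-zero N (λ i j _ _ → ℤP.*-zeroˡ (w i j)))
  pairing-as-sum N w (t@(c , i₀ , j₀) ∷ K) ((i₀<N , j₀<N) ∷ K<N) = sym (begin
    sumBelow² N (λ i j → coeff (t ∷ K) i j * w i j)
      ≡⟨ sumBelow²-cong N (λ i j _ _ → trans (cong (_* w i j) (coeff-∷ t K i j))
                                             (ℤP.*-distribʳ-+ (w i j) (coeff₁ t i j) (coeff K i j))) ⟩
    sumBelow² N (λ i j → coeff₁ t i j * w i j + coeff K i j * w i j)
      ≡⟨ sumBelow²-+ N (λ i j → coeff₁ t i j * w i j) (λ i j → coeff K i j * w i j) ⟩
    sumBelow² N (λ i j → coeff₁ t i j * w i j) + sumBelow² N (λ i j → coeff K i j * w i j)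
      ≡⟨ cong₂ _+_ (sumBelow²-single N i₀ j₀ i₀<N j₀<N t-vanishes) (sym (pairing-as-sum N w K K<N)) ⟩
    coeff₁ t i₀ j₀ * w i₀ j₀ + ⟪ K , w ⟫
      ≡⟨ cong (λ z → z * w i₀ j₀ + ⟪ K , w ⟫) (coeff₁-≡ c i₀ j₀) ⟩
    c * w i₀ j₀ + ⟪ K , w ⟫ ∎)
    where
      open ≡-Reasoning
      t-vanishes : ∀ i j → i ℕ.< N → j ℕ.< N → ¬ (i ≡ i₀ × j ≡ j₀) → coeff₁ t i j * w i j ≡ + 0
      t-vanishes i j _ _ ≢ = trans (cong (_* w i j) (coeff₁-avoids t λ (e₁ , e₂) → ≢ (sym e₁ , sym e₂)))
                                   (ℤP.*-zeroˡ (w i j))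

  pairing-cong-mod : ∀ {m K K'} w → K ≈ K' [mod m ] → ⟪ K , w ⟫ ≡ ⟪ K' , w ⟫ [mod m ]
  pairing-cong-mod {m} {K} {K'} w K≈K' with bounded (K ++ K')
  ... | N , KK'<N =
    subst₂ _≡_[mod m ] (sym (pairing-as-sum N w K (AllP.++⁻ˡ K KK'<N)))
                       (sym (pairing-as-sum N w K' (AllP.++⁻ʳ K KK'<N)))
           (sumBelow²-cong-mod N (λ i j _ _ → *-congʳ-mod (w i j) (coeff-≡-mod K≈K' i j)))

module TermAlgebra (E : Set) (_⊕_ : E → E → E) (e₀ : E) (_≟E_ : DecidableEquality E)
  (⊕-isCommutativeMonoid : IsCommutativeMonoid _≡_ _⊕_ e₀)
  (⊕-cancelˡ : LeftCancellative _≡_ _⊕_)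
  (_⊕-divides?_ : ∀ a x → Dec (∃ λ x' → a ⊕ x' ≡ x))
  where

  open Coefficients E _⊕_ e₀ _≟E_ public
  open IsCommutativeMonoid ⊕-isCommutativeMonoid
    using () renaming (assoc to ⊕-assoc; comm to ⊕-comm; identityˡ to ⊕-identityˡ)

  infixl 7 _·_
  _·_ : Term → Term → Term
  (c , a , b) · (d , a' , b') = (c * d , a ⊕ a' , b ⊕ b')

  ·-comm : ∀ t s → t · s ≡ s · t
  ·-comm (c , a , b) (d , a' , b') = cong₂ _,_ (ℤP.*-comm c d) (cong₂ _,_ (⊕-comm a a') (⊕-comm b b'))

  ·-assoc : ∀ t s r → (t · s) · r ≡ t · (s · r)
  ·-assoc (c , a , b) (d , a' , b') (e , a'' , b'') =
    cong₂ _,_ (ℤP.*-assoc c d e) (cong₂ _,_ (⊕-assoc a a' a'') (⊕-assoc b b' b''))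

  coeff₁-· : ∀ c a b s x y → coeff₁ ((c , a , b) · s) (a ⊕ x) (b ⊕ y) ≡ c * coeff₁ s x y
  coeff₁-· c a b s@(d , a' , b') x y with (a' ≟E x) ×-dec (b' ≟E y)
  ... | yes (refl , refl) = trans (coeff₁-≡ (c * d) (a ⊕ a') (b ⊕ b')) (cong (c *_) (sym (coeff₁-≡ d a' b')))
  ... | no ≢ = trans (coeff₁-avoids ((c , a , b) · s)
                              (λ (e₁ , e₂) → ≢ (⊕-cancelˡ a a' x e₁ , ⊕-cancelˡ b b' y e₂)))
                     (trans (sym (ℤP.*-zeroʳ c)) (cong (c *_) (sym (coeff₁-avoids s ≢))))

  coeff-·-shift : ∀ c a b Q x y → coeff (map ((c , a , b) ·_) Q) (a ⊕ x) (b ⊕ y) ≡ c * coeff Q x y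
  coeff-·-shift c a b Q x y =
    coeff-map _ (c *_) (ℤP.*-zeroʳ c) (ℤP.*-distribˡ-+ c) (λ s → coeff₁-· c a b s x y) Q

  coeff-·-outside : ∀ c a b Q {x y} → ¬ ((∃ λ x' → a ⊕ x' ≡ x) × (∃ λ y' → b ⊕ y' ≡ y)) →
                    coeff (map ((c , a , b) ·_) Q) x y ≡ + 0
  coeff-·-outside c a b Q outside = coeff-avoids (map _ Q)
    (AllP.map⁺ (All.universal (λ { (_ , a' , b') (e₁ , e₂) → outside ((a' , e₁) , (b' , e₂)) }) Q))

  ⊠-zeroʳ : ∀ P → P ⊠ [] ≡ []
  ⊠-zeroʳ []      = refl
  ⊠-zeroʳ (_ ∷ P) = ⊠-zeroʳ P

  coeff-⊠-∷ʳ : ∀ P s Q a b → coeff (P ⊠ (s ∷ Q)) a b ≡ coeff (map (_· s) P) a b + coeff (P ⊠ Q) a b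
  coeff-⊠-∷ʳ []      s Q a b = refl
  coeff-⊠-∷ʳ (t ∷ P) s Q a b = begin
    coeff (t · s ∷ (map (t ·_) Q ++ P ⊠ (s ∷ Q))) a b
      ≡⟨ coeff-∷ (t · s) _ a b ⟩
    coeff₁ (t · s) a b + coeff (map (t ·_) Q ++ P ⊠ (s ∷ Q)) a b
      ≡⟨ cong (λ z → coeff₁ (t · s) a b + z) (trans (coeff-++ (map (t ·_) Q) _ a b)
              (cong (λ z → coeff (map (t ·_) Q) a b + z) (coeff-⊠-∷ʳ P s Q a b))) ⟩
    coeff₁ (t · s) a b + (coeff (map (t ·_) Q) a b + (coeff (map (_· s) P) a b + coeff (P ⊠ Q) a b))
      ≡⟨ interchange (coeff₁ (t · s) a b) (coeff (map (t ·_) Q) a b) (coeff (map (_· s) P) a b) (coeff (P ⊠ Q) a b) ⟩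
    (coeff₁ (t · s) a b + coeff (map (_· s) P) a b) + (coeff (map (t ·_) Q) a b + coeff (P ⊠ Q) a b)
      ≡⟨ cong₂ _+_ (coeff-∷ (t · s) _ a b) (coeff-++ (map (t ·_) Q) (P ⊠ Q) a b) ⟨
    coeff (map (_· s) (t ∷ P)) a b + coeff ((t ∷ P) ⊠ Q) a b ∎
    where
      open ≡-Reasoning
      interchange : ∀ w x y z → w + (x + (y + z)) ≡ (w + y) + (x + z)
      interchange = solve-∀

  ⊠-comm : ∀ P Q → (P ⊠ Q) ≐ (Q ⊠ P)
  ⊠-comm []      Q a b = cong (λ L → coeff L a b) (sym (⊠-zeroʳ Q))
  ⊠-comm (t ∷ P) Q a b = begin
    coeff (map (t ·_) Q ++ P ⊠ Q) a b                  ≡⟨ coeff-++ (map (t ·_) Q) (P ⊠ Q) a b ⟩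
    coeff (map (t ·_) Q) a b + coeff (P ⊠ Q) a b       ≡⟨ cong₂ _+_ (cong (λ L → coeff L a b) (ListP.map-cong (·-comm t) Q))
                                                                     (⊠-comm P Q a b) ⟩
    coeff (map (_· t) Q) a b + coeff (Q ⊠ P) a b       ≡⟨ coeff-⊠-∷ʳ Q t P a b ⟨
    coeff (Q ⊠ (t ∷ P)) a b                            ∎
    where open ≡-Reasoning

  map-·-⊠ : ∀ t Q R → map (t ·_) Q ⊠ R ≡ map (t ·_) (Q ⊠ R)
  map-·-⊠ t []      R = refl
  map-·-⊠ t (s ∷ Q) R =
    trans (cong₂ _++_ (trans (ListP.map-cong (·-assoc t s) R) (ListP.map-∘ R)) (map-·-⊠ t Q R))
          (sym (ListP.map-++ (t ·_) (map (s ·_) R) (Q ⊠ R)))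

  ⊠-assoc : ∀ P Q R → (P ⊠ Q) ⊠ R ≡ P ⊠ (Q ⊠ R)
  ⊠-assoc []      Q R = refl
  ⊠-assoc (t ∷ P) Q R = trans (ListP.concatMap-++ (λ s → map (s ·_) R) (map (t ·_) Q) (P ⊠ Q))
                              (cong₂ _++_ (map-·-⊠ t Q R) (⊠-assoc P Q R))

  ⊠-identityˡ : ∀ P → const (+ 1) ⊠ P ≡ P
  ⊠-identityˡ P = trans (ListP.++-identityʳ _)
    (trans (ListP.map-cong identity-· P) (ListP.map-id P))
    where
      identity-· : ∀ t → (+ 1 , e₀ , e₀) · t ≡ t
      identity-· (d , a , b) = cong₂ _,_ (ℤP.*-identityˡ d) (cong₂ _,_ (⊕-identityˡ a) (⊕-identityˡ b))

  ⊠-identityʳ : ∀ P → (P ⊠ const (+ 1)) ≐ P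
  ⊠-identityʳ P a b = trans (⊠-comm P _ a b) (cong (λ L → coeff L a b) (⊠-identityˡ P))

  coeff-const-⊠ : ∀ c A B a b → coeff ((const c ⊠ A) ⊠ B) a b ≡ c * coeff (A ⊠ B) a b
  coeff-const-⊠ c A B a b = begin
    coeff ((const c ⊠ A) ⊠ B) a b
      ≡⟨ cong (λ L → coeff (L ⊠ B) a b) (ListP.++-identityʳ (map (scalar ·_) A)) ⟩
    coeff (map (scalar ·_) A ⊠ B) a b
      ≡⟨ cong (λ L → coeff L a b) (map-·-⊠ scalar A B) ⟩
    coeff (map (scalar ·_) (A ⊠ B)) a b
      ≡⟨ subst₂ (λ x y → coeff (map (scalar ·_) (A ⊠ B)) x y ≡ c * coeff (A ⊠ B) a b)
                (⊕-identityˡ a) (⊕-identityˡ b) (coeff-·-shift c e₀ e₀ (A ⊠ B) a b) ⟩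
    c * coeff (A ⊠ B) a b ∎
    where
      open ≡-Reasoning
      scalar : Term
      scalar = (c , e₀ , e₀)

  coeff-eval : ∀ H f g a b → coeff (eval H f g) a b ≡ ⟪ H , (λ i j → coeff (pow f i ⊠ pow g j) a b) ⟫
  coeff-eval []                f g a b = refl
  coeff-eval ((c , i , j) ∷ H) f g a b =
    trans (coeff-++ ((const c ⊠ pow f i) ⊠ pow g j) (eval H f g) a b)
          (cong₂ _+_ (coeff-const-⊠ c (pow f i) (pow g j) a b) (coeff-eval H f g a b))

  eval-X^ : ∀ k f g → eval (Poly.pow X k) f g ≐ pow f k
  eval-X^ k f g a b rewrite pow-X k = trans (coeff-eval ((+ 1 , k , 0) ∷ []) f g a b) $
    trans (ℤP.+-identityʳ _) (trans (ℤP.*-identityˡ _) (⊠-identityʳ (pow f k) a b))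

  eval-Y^ : ∀ k f g → eval (Poly.pow Y k) f g ≐ pow g k
  eval-Y^ k f g a b rewrite pow-Y k = trans (coeff-eval ((+ 1 , 0 , k) ∷ []) f g a b) $
    trans (ℤP.+-identityʳ _) (trans (ℤP.*-identityˡ _) (cong (λ L → coeff L a b) (⊠-identityˡ (pow g k))))

  All-⊠ : ∀ {R₁ R₂ R₃ : Term → Set} → (∀ {t s} → R₁ t → R₂ s → R₃ (t · s)) →
          ∀ {P Q} → All R₁ P → All R₂ Q → All R₃ (P ⊠ Q)
  All-⊠ R₁·R₂ []           R₂Q = []
  All-⊠ R₁·R₂ (R₁t ∷ R₁P) R₂Q = AllP.++⁺ (AllP.map⁺ (All.map (R₁·R₂ R₁t) R₂Q)) (All-⊠ R₁·R₂ R₁P R₂Q)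

  module _ {m : ℕ} where

    map-·-cong-mod : ∀ t {Q Q'} → Q ≈ Q' [mod m ] → map (t ·_) Q ≈ map (t ·_) Q' [mod m ]
    map-·-cong-mod (c , a , b) {Q} {Q'} Q≈Q' = mk≈mod congruent
      where
        congruent : ∀ x y → coeff (map ((c , a , b) ·_) Q) x y ≡ coeff (map ((c , a , b) ·_) Q') x y [mod m ]
        congruent x y with (a ⊕-divides? x) ×-dec (b ⊕-divides? y)
        ... | yes ((x' , refl) , (y' , refl)) =
          subst₂ _≡_[mod m ] (sym (coeff-·-shift c a b Q x' y')) (sym (coeff-·-shift c a b Q' x' y'))
                 (*-congˡ-mod c (coeff-≡-mod Q≈Q' x' y'))
        ... | no outside = ≡⇒≡-mod (trans (coeff-·-outside c a b Q outside) (sym (coeff-·-outside c a b Q' outside)))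

    ⊠-congʳ-mod : ∀ P {Q Q'} → Q ≈ Q' [mod m ] → P ⊠ Q ≈ P ⊠ Q' [mod m ]
    ⊠-congʳ-mod []      Q≈Q' = ≈-mod-refl
    ⊠-congʳ-mod (t ∷ P) Q≈Q' = ⊞-cong-mod (map-·-cong-mod t Q≈Q') (⊠-congʳ-mod P Q≈Q')

    ⊠-cong-mod : ∀ {P P' Q Q'} → P ≈ P' [mod m ] → Q ≈ Q' [mod m ] → P ⊠ Q ≈ P' ⊠ Q' [mod m ]
    ⊠-cong-mod {P} {P'} {Q} {Q'} P≈P' Q≈Q' =
      ≈-mod-trans (⊠-congʳ-mod P Q≈Q') (≈-mod-trans (≐⇒≈-mod (⊠-comm P Q'))
        (≈-mod-trans (⊠-congʳ-mod Q' P≈P') (≐⇒≈-mod (⊠-comm Q' P'))))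

    eval-congˡ-mod : ∀ {G G'} f g → G PolyCoeff.≈ G' [mod m ] → eval G f g ≈ eval G' f g [mod m ]
    eval-congˡ-mod {G} {G'} f g G≈G' = mk≈mod λ a b →
      subst₂ _≡_[mod m ] (sym (coeff-eval G f g a b)) (sym (coeff-eval G' f g a b)) (pairing-cong-mod _ G≈G')

  +-*-isCommutativeSemiring-mod : ∀ m → IsCommutativeSemiring _≈_[mod m ] _⊞_ _⊠_ [] (const (+ 1))
  +-*-isCommutativeSemiring-mod m = Biased.isCommutativeSemiringˡ record
    { +-isCommutativeMonoid = record
      { isMonoid = record
        { isSemigroup = record
          { isMagma = record { isEquivalence = ≈-isEquivalence ; ∙-cong = ⊞-cong-mod }
          ; assoc = λ P Q R → ≡⇒≈-mod (ListP.++-assoc P Q R) }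
        ; identity = (λ P → ≈-mod-refl) , (λ P → ≡⇒≈-mod (ListP.++-identityʳ P)) }
      ; comm = λ P Q → ≐⇒≈-mod λ a b →
          trans (coeff-++ P Q a b) (trans (ℤP.+-comm (coeff P a b) _) (sym (coeff-++ Q P a b))) }
    ; *-isCommutativeMonoid = record
      { isMonoid = record
        { isSemigroup = record
          { isMagma = record { isEquivalence = ≈-isEquivalence ; ∙-cong = ⊠-cong-mod }
          ; assoc = λ P Q R → ≡⇒≈-mod (⊠-assoc P Q R) }
        ; identity = (λ P → ≡⇒≈-mod (⊠-identityˡ P)) , (λ P → ≐⇒≈-mod (⊠-identityʳ P)) }
      ; comm = λ P Q → ≐⇒≈-mod (⊠-comm P Q) }
    ; distribʳ = λ P Q R → ≡⇒≈-mod (ListP.concatMap-++ _ Q R)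
    ; zeroˡ = λ P → ≈-mod-refl }
    where
      ≈-isEquivalence : IsEquivalence _≈_[mod m ]
      ≈-isEquivalence = record { refl = ≈-mod-refl ; sym = ≈-mod-sym ; trans = ≈-mod-trans }

  commutativeSemiring-mod : ℕ → CommutativeSemiring 0ℓ 0ℓ
  commutativeSemiring-mod m = record { isCommutativeSemiring = +-*-isCommutativeSemiring-mod m }

  module _ (m : ℕ) where
    open CommutativeSemiring (commutativeSemiring-mod m) using (semiring)
    open import Algebra.Properties.Semiring.Mult semiring using () renaming (_×_ to _×ₘ_)
    open import Algebra.Properties.Semiring.Exp semiring using () renaming (_^_ to _^ₘ_)
    open Frobenius (commutativeSemiring-mod m) using (CharDivides)

    coeff-× : ∀ k P a b → coeff (k ×ₘ P) a b ≡ + k * coeff P a b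
    coeff-× zero    P a b = sym (ℤP.*-zeroˡ (coeff P a b))
    coeff-× (suc k) P a b = trans (coeff-++ P (k ×ₘ P) a b)
      (trans (cong (λ z → coeff P a b + z) (coeff-× k P a b)) (identity (coeff P a b) (+ k)))
      where identity : ∀ x k → x + k * x ≡ (+ 1 + k) * x
            identity = solve-∀

    charDivides : CharDivides m
    charDivides k P m∣k = mk≈mod λ a b → ∣⇒≡0-mod
      (subst ((+ m) ∣_) (sym (coeff-× k P a b)) (∣m⇒∣m*n (coeff P a b) (∣ᵤ⇒∣ {+ m} {+ k} m∣k)))

    ^≡pow : ∀ P k → P ^ₘ k ≡ pow P k
    ^≡pow P zero    = refl
    ^≡pow P (suc k) = cong (P ⊠_) (^≡pow P k)

  pow-⊞-frobenius : ∀ {p} → Prime p → ∀ n P Q → pow (P ⊞ Q) (p ^ n) ≈ pow P (p ^ n) ⊞ pow Q (p ^ n) [mod p ]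
  pow-⊞-frobenius {p} pr n P Q =
    subst₂ _≈_[mod p ] (^≡pow p (P ⊞ Q) (p ^ n)) (cong₂ _⊞_ (^≡pow p P (p ^ n)) (^≡pow p Q (p ^ n)))
           (Frobenius.frobenius-^ (commutativeSemiring-mod p) pr (charDivides p) n P Q)

ℕ-+-divides? : ∀ a x → Dec (∃ λ x' → a ℕ.+ x' ≡ x)
ℕ-+-divides? a x with a ℕ.≤? x
... | yes a≤x = yes (x ∸ a , ℕP.m+[n∸m]≡n a≤x)
... | no  a≰x = no λ (x' , a+x'≡x) → a≰x (subst (a ℕ.≤_) a+x'≡x (ℕP.m≤m+n a x'))

ℤ-+-divides? : ∀ a x → Dec (∃ λ x' → a + x' ≡ x)
ℤ-+-divides? a x = yes (x - a , identity a x)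
  where identity : ∀ a x → a + (x - a) ≡ x
        identity = solve-∀

module PolyAlg = TermAlgebra ℕ ℕ._+_ 0 ℕ._≟_ ℕP.+-0-isCommutativeMonoid ℕP.+-cancelˡ-≡ ℕ-+-divides?
module LaurentAlg = TermAlgebra ℤ _+_ (+ 0) ℤ._≟_ ℤP.+-0-isCommutativeMonoid ℤ-+-cancelˡ ℤ-+-divides?

UnitCoefficients : LPoly → Set
UnitCoefficients = All (λ t → proj₁ t ≡ + 1)

module _ where
  open LaurentAlg

  pow-monomial : ∀ a b k → pow ((+ 1 , a , b) ∷ []) k ≡ (+ 1 , + k * a , + k * b) ∷ []
  pow-monomial a b zero    = cong₂ (λ x y → (+ 1 , x , y) ∷ []) (sym (ℤP.*-zeroˡ a)) (sym (ℤP.*-zeroˡ b))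
  pow-monomial a b (suc k) rewrite pow-monomial a b k =
    cong₂ (λ x y → (+ 1 , x , y) ∷ []) (identity a (+ k)) (identity b (+ k))
    where identity : ∀ x k → x + k * x ≡ (+ 1 + k) * x
          identity = solve-∀

  pow-[] : ∀ k → 0 ℕ.< k → pow [] k ≡ []
  pow-[] (suc k) _ = refl

  pow-frobenius-dilate : ∀ {p} → Prime p → ∀ n Q → UnitCoefficients Q → pow Q (p ^ n) ≈ dilate (p ^ n) Q [mod p ]
  pow-frobenius-dilate {p} pr n [] [] = ≡⇒≈-mod (pow-[] (p ^ n) (ℕP.m^n>0 p {{prime⇒nonZero pr}} n))
  pow-frobenius-dilate {p} pr n ((_ , a , b) ∷ Q) (refl ∷ Q-unit) =
    ≈-mod-trans (pow-⊞-frobenius pr n ((+ 1 , a , b) ∷ []) Q)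
                (⊞-cong-mod (≡⇒≈-mod (pow-monomial a b (p ^ n))) (pow-frobenius-dilate pr n Q Q-unit))

  -- Chosen so that uv and uv² are the unique heaviest monomials of φ₁ and φ₂.
  weight : ℤ → ℤ → ℤ
  weight a b = + 2 * a + + 3 * b

  weightOf : Term → ℤ
  weightOf (_ , a , b) = weight a b

  weightOf-· : ∀ t s → weightOf (t · s) ≡ weightOf t + weightOf s
  weightOf-· (_ , a , b) (_ , a' , b') = identity a b a' b'
    where identity : ∀ a b a' b' → + 2 * (a + a') + + 3 * (b + b') ≡ (+ 2 * a + + 3 * b) + (+ 2 * a' + + 3 * b')
          identity = solve-∀

  DominatedBy : ℤ → ℤ → Term → Set
  DominatedBy a b t@(_ , a' , b') = weightOf t ℤ.< weight a b ⊎ (a' ≡ a × b' ≡ b)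

  dominated-≤ : ∀ {a b} t → DominatedBy a b t → weightOf t ℤ.≤ weight a b
  dominated-≤ t (inj₁ lighter)      = ℤP.<⇒≤ lighter
  dominated-≤ t (inj₂ (refl , refl)) = ℤP.≤-refl

  lighter-avoids : ∀ {a b} t → weightOf t ℤ.< weight a b → Avoids a b t
  lighter-avoids t lighter (refl , refl) = ℤP.<-irrefl refl lighter

  lighter-· : ∀ {a b a' b'} t s → weightOf t + weightOf s ℤ.< weight a b + weight a' b' →
              weightOf (t · s) ℤ.< weight (a + a') (b + b')
  lighter-· {a} {b} {a'} {b'} t s =
    subst₂ ℤ._<_ (sym (weightOf-· t s)) (sym (weightOf-· (+ 0 , a , b) (+ 0 , a' , b')))

  dominated-· : ∀ {a b a' b'} t s → DominatedBy a b t → DominatedBy a' b' s → DominatedBy (a + a') (b + b') (t · s)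
  dominated-· {a} {b} {a'} {b'} t s (inj₁ t-lighter) s-dom =
    inj₁ (lighter-· {a} {b} {a'} {b'} t s (ℤP.+-mono-<-≤ t-lighter (dominated-≤ s s-dom)))
  dominated-· {a} {b} {a'} {b'} t s (inj₂ (refl , refl)) (inj₁ s-lighter) =
    inj₁ (lighter-· {a} {b} {a'} {b'} t s (ℤP.+-mono-≤-< (ℤP.≤-refl {weightOf t}) s-lighter))
  dominated-· t s (inj₂ (refl , refl)) (inj₂ (refl , refl)) = inj₂ (refl , refl)

  coeff-⊠-dominated : ∀ {a b a' b'} P Q → All (DominatedBy a b) P → All (DominatedBy a' b') Q →
                      coeff (P ⊠ Q) (a + a') (b + b') ≡ coeff P a b * coeff Q a' b'
  coeff-⊠-dominated {a' = a'} {b'} [] Q [] _ = sym (ℤP.*-zeroˡ (coeff Q a' b'))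
  coeff-⊠-dominated {a} {b} {a'} {b'} (t ∷ P) Q (t-dom ∷ P-dom) Q-dom = begin
    coeff (map (t ·_) Q ++ P ⊠ Q) (a + a') (b + b')
      ≡⟨ coeff-++ (map (t ·_) Q) (P ⊠ Q) _ _ ⟩
    coeff (map (t ·_) Q) (a + a') (b + b') + coeff (P ⊠ Q) (a + a') (b + b')
      ≡⟨ cong₂ _+_ (row t t-dom) (coeff-⊠-dominated P Q P-dom Q-dom) ⟩
    coeff₁ t a b * coeff Q a' b' + coeff P a b * coeff Q a' b'
      ≡⟨ ℤP.*-distribʳ-+ (coeff Q a' b') (coeff₁ t a b) (coeff P a b) ⟨
    (coeff₁ t a b + coeff P a b) * coeff Q a' b'
      ≡⟨ cong (_* coeff Q a' b') (coeff-∷ t P a b) ⟨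
    coeff (t ∷ P) a b * coeff Q a' b' ∎
    where
      open ≡-Reasoning
      row : ∀ t → DominatedBy a b t → coeff (map (t ·_) Q) (a + a') (b + b') ≡ coeff₁ t a b * coeff Q a' b'
      row (c , _ , _) (inj₂ (refl , refl)) =
        trans (coeff-·-shift c a b Q a' b') (cong (_* coeff Q a' b') (sym (coeff₁-≡ c a b)))
      row t (inj₁ t-lighter) = trans
        (coeff-avoids (map (t ·_) Q) (AllP.map⁺ (All.map (λ {s} s-dom → lighter-avoids {a + a'} {b + b'} (t · s)
          (lighter-· {a} {b} {a'} {b'} t s (ℤP.+-mono-<-≤ t-lighter (dominated-≤ s s-dom)))) Q-dom)))
        (sym (trans (cong (_* coeff Q a' b') (coeff₁-avoids t (lighter-avoids t t-lighter))) (ℤP.*-zeroˡ (coeff Q a' b'))))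

  record Monic (Q : LPoly) (a b : ℤ) : Set where
    field
      dominated   : All (DominatedBy a b) Q
      leading-one : coeff Q a b ≡ + 1

  Monic-resp : ∀ {Q a b a' b'} → a ≡ a' → b ≡ b' → Monic Q a b → Monic Q a' b'
  Monic-resp refl refl Q-monic = Q-monic

  Monic-⊠ : ∀ {P Q a b a' b'} → Monic P a b → Monic Q a' b' → Monic (P ⊠ Q) (a + a') (b + b')
  Monic-⊠ {P} {Q} P-monic Q-monic = record
    { dominated   = All-⊠ (λ {t} {s} → dominated-· t s) (Monic.dominated P-monic) (Monic.dominated Q-monic)
    ; leading-one = trans (coeff-⊠-dominated P Q (Monic.dominated P-monic) (Monic.dominated Q-monic))
                          (cong₂ _*_ (Monic.leading-one P-monic) (Monic.leading-one Q-monic)) }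

  Monic-pow : ∀ {Q a b} → Monic Q a b → ∀ k → Monic (pow Q k) (+ k * a) (+ k * b)
  Monic-pow {a = a} {b} _ zero = Monic-resp (sym (ℤP.*-zeroˡ a)) (sym (ℤP.*-zeroˡ b))
    record { dominated = inj₂ (refl , refl) ∷ [] ; leading-one = refl }
  Monic-pow {a = a} {b} Q-monic (suc k) =
    Monic-resp (identity a (+ k)) (identity b (+ k)) (Monic-⊠ Q-monic (Monic-pow Q-monic k))
    where identity : ∀ x k → x + k * x ≡ (+ 1 + k) * x
          identity = solve-∀

  <-by-computation : ∀ {x y} {x<y : True (x ℤ.<? y)} → x ℤ.< y
  <-by-computation {x<y = x<y} = toWitness x<y

  Monic-φ₁ : Monic φ₁ (+ 1) (+ 1)
  Monic-φ₁ = record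
    { dominated   = inj₁ <-by-computation ∷ inj₁ <-by-computation ∷ inj₂ (refl , refl)
                  ∷ inj₁ <-by-computation ∷ inj₁ <-by-computation ∷ inj₁ <-by-computation ∷ []
    ; leading-one = refl }

  Monic-φ₂ : Monic φ₂ (+ 1) (+ 2)
  Monic-φ₂ = record
    { dominated   = inj₁ <-by-computation ∷ inj₂ (refl , refl) ∷ inj₁ <-by-computation
                  ∷ inj₁ <-by-computation ∷ inj₁ <-by-computation ∷ inj₁ <-by-computation ∷ []
    ; leading-one = refl }

  φ-monomial : ℕ → ℕ → LPoly
  φ-monomial i j = pow φ₁ i ⊠ pow φ₂ j

  leadᵤ leadᵥ : ℕ → ℕ → ℤ
  leadᵤ i j = + i + + j
  leadᵥ i j = + i + (+ j + + j)

  rank : ℕ → ℕ → ℕ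
  rank i j = 5 ℕ.* i ℕ.+ 8 ℕ.* j

  Monic-φ-monomial : ∀ i j → Monic (φ-monomial i j) (leadᵤ i j) (leadᵥ i j)
  Monic-φ-monomial i j = Monic-resp (identityᵤ (+ i) (+ j)) (identityᵥ (+ i) (+ j))
                                    (Monic-⊠ (Monic-pow Monic-φ₁ i) (Monic-pow Monic-φ₂ j))
    where identityᵤ : ∀ x y → x * + 1 + y * + 1 ≡ x + y
          identityᵤ = solve-∀
          identityᵥ : ∀ x y → x * + 1 + y * + 2 ≡ x + (y + y)
          identityᵥ = solve-∀

  weight-lead : ∀ i j → weight (leadᵤ i j) (leadᵥ i j) ≡ + rank i j
  weight-lead i j = trans (identity (+ i) (+ j))
    (sym (trans (ℤP.pos-+ (5 ℕ.* i) (8 ℕ.* j)) (cong₂ _+_ (ℤP.pos-* 5 i) (ℤP.pos-* 8 j))))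
    where identity : ∀ x y → + 2 * (x + y) + + 3 * (x + (y + y)) ≡ + 5 * x + + 8 * y
          identity = solve-∀

  lead-injective : ∀ {i j i₀ j₀} → leadᵤ i j ≡ leadᵤ i₀ j₀ → leadᵥ i j ≡ leadᵥ i₀ j₀ → i ≡ i₀ × j ≡ j₀
  lead-injective {i} {j} {i₀} {j₀} eqᵤ eqᵥ = ℤP.+-injective i≡i₀ , ℤP.+-injective j≡j₀
    where
      j-from : ∀ x y → (x + (y + y)) - (x + y) ≡ y
      j-from = solve-∀
      i-from : ∀ x y → (x + y) - y ≡ x
      i-from = solve-∀
      j≡j₀ : + j ≡ + j₀
      j≡j₀ = trans (sym (j-from (+ i) (+ j))) (trans (cong₂ _-_ eqᵥ eqᵤ) (j-from (+ i₀) (+ j₀)))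
      i≡i₀ : + i ≡ + i₀
      i≡i₀ = trans (sym (i-from (+ i) (+ j))) (trans (cong₂ _-_ eqᵤ j≡j₀) (i-from (+ i₀) (+ j₀)))

  φ-monomial-lead : ∀ i j → coeff (φ-monomial i j) (leadᵤ i j) (leadᵥ i j) ≡ + 1
  φ-monomial-lead i j = Monic.leading-one (Monic-φ-monomial i j)

  φ-monomial-below : ∀ {i j i₀ j₀} → rank i j ℕ.≤ rank i₀ j₀ → ¬ (i ≡ i₀ × j ≡ j₀) →
                     coeff (φ-monomial i j) (leadᵤ i₀ j₀) (leadᵥ i₀ j₀) ≡ + 0
  φ-monomial-below {i} {j} {i₀} {j₀} rank≤ ≢ =
    coeff-avoids (φ-monomial i j) (All.map (λ {t} → avoids t) (Monic.dominated (Monic-φ-monomial i j)))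
    where
      weight≤ : weight (leadᵤ i j) (leadᵥ i j) ℤ.≤ weight (leadᵤ i₀ j₀) (leadᵥ i₀ j₀)
      weight≤ = subst₂ ℤ._≤_ (sym (weight-lead i j)) (sym (weight-lead i₀ j₀)) (ℤ.+≤+ rank≤)
      avoids : ∀ t → DominatedBy (leadᵤ i j) (leadᵥ i j) t → Avoids (leadᵤ i₀ j₀) (leadᵥ i₀ j₀) t
      avoids t           (inj₁ lighter)       = lighter-avoids t (ℤP.<-≤-trans lighter weight≤)
      avoids (_ , _ , _) (inj₂ (refl , refl)) (eqᵤ , eqᵥ) = ≢ (lead-injective eqᵤ eqᵥ)

φ-table : ℤ → ℤ → ℕ → ℕ → ℤ
φ-table x y i j = LaurentAlg.coeff (φ-monomial i j) x y

module Independence {m : ℕ} (K : Poly) (K-vanishes : ∀ x y → (+ m) ∣ ⟪ K , φ-table x y ⟫) where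
  open PolyAlg using (coeff; coeff₁; coeff₁-≡; coeff₁-avoids; coeff-avoids)

  private
    N : ℕ
    N = proj₁ (bounded K)
    K<N : Bounded N K
    K<N = proj₂ (bounded K)

  coeff-outside : ∀ i j → ¬ (i ℕ.< N × j ℕ.< N) → (+ m) ∣ coeff K i j
  coeff-outside i j outside =
    subst ((+ m) ∣_) (sym (coeff-avoids K (All.map (λ {t} → avoids t) K<N))) ∣0
    where
      avoids : ∀ t → InBox N t → PolyAlg.Avoids i j t
      avoids (_ , _ , _) inside (refl , refl) = outside inside

  coeff-divisible-at : ∀ i₀ j₀ → (∀ i j → rank i₀ j₀ ℕ.< rank i j → (+ m) ∣ coeff K i j) → (+ m) ∣ coeff K i₀ j₀
  coeff-divisible-at i₀ j₀ heavier-divisible with (i₀ ℕ.<? N) ×-dec (j₀ ℕ.<? N)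
  ... | no outside = coeff-outside i₀ j₀ outside
  ... | yes (i₀<N , j₀<N) =
    ≡0-mod⇒∣ (≡-mod-trans (≡-mod-sym pairing≡c₀) (∣⇒≡0-mod (K-vanishes (leadᵤ i₀ j₀) (leadᵥ i₀ j₀))))
    where
      c₀ = coeff K i₀ j₀
      w₀ = φ-table (leadᵤ i₀ j₀) (leadᵥ i₀ j₀)

      vanishing-term : ∀ i j → ¬ (i ≡ i₀ × j ≡ j₀) → coeff K i j * w₀ i j ≡ + 0 [mod m ]
      vanishing-term i j ≢ with rank i j ℕ.≤? rank i₀ j₀
      ... | yes lighter = ≡⇒≡-mod (trans (cong (coeff K i j *_) (φ-monomial-below lighter ≢)) (ℤP.*-zeroʳ (coeff K i j)))
      ... | no  heavier = ∣⇒≡0-mod (∣m⇒∣m*n (w₀ i j) (heavier-divisible i j (ℕP.≰⇒> heavier)))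

      δ-vanishes : ∀ i j → ¬ (i ≡ i₀ × j ≡ j₀) → coeff₁ (c₀ , i₀ , j₀) i j ≡ + 0
      δ-vanishes i j ≢ = coeff₁-avoids (c₀ , i₀ , j₀) λ (e₁ , e₂) → ≢ (sym e₁ , sym e₂)

      term≡ : ∀ i j → coeff K i j * w₀ i j ≡ coeff₁ (c₀ , i₀ , j₀) i j [mod m ]
      term≡ i j with (i ℕ.≟ i₀) ×-dec (j ℕ.≟ j₀)
      ... | yes (refl , refl) = ≡⇒≡-mod (trans (cong (c₀ *_) (φ-monomial-lead i₀ j₀))
                                        (trans (ℤP.*-identityʳ c₀) (sym (coeff₁-≡ c₀ i₀ j₀))))
      ... | no ≢ = ≡-mod-trans (vanishing-term i j ≢) (≡⇒≡-mod (sym (δ-vanishes i j ≢)))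

      pairing≡c₀ : ⟪ K , w₀ ⟫ ≡ c₀ [mod m ]
      pairing≡c₀ = subst₂ _≡_[mod m ] (sym (pairing-as-sum N w₀ K K<N))
        (trans (sumBelow²-single N i₀ j₀ i₀<N j₀<N (λ i j _ _ → δ-vanishes i j)) (coeff₁-≡ c₀ i₀ j₀))
        (sumBelow²-cong-mod N (λ i j _ _ → term≡ i j))

  -- Downward induction on rank with fuel k; inside the box i, j < N every rank is below 13 N.
  divisible-above : ∀ k i j → 13 ℕ.* N ℕ.≤ rank i j ℕ.+ k → (+ m) ∣ coeff K i j
  divisible-above zero    i j 13N≤rank = coeff-outside i j λ (i<N , j<N) →
    ℕP.<⇒≱ (ℕP.+-mono-<-≤ (ℕP.*-monoʳ-< 5 i<N) (ℕP.*-monoʳ-≤ 8 (ℕP.<⇒≤ j<N)))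
           (subst₂ ℕ._≤_ (ℕP.*-distribʳ-+ N 5 8) (ℕP.+-identityʳ (rank i j)) 13N≤rank)
  divisible-above (suc k) i₀ j₀ 13N≤rank+1+k = coeff-divisible-at i₀ j₀ λ i j heavier →
    divisible-above k i j (ℕP.≤-trans (subst (13 ℕ.* N ℕ.≤_) (ℕP.+-suc (rank i₀ j₀) k) 13N≤rank+1+k)
                                      (ℕP.+-monoˡ-≤ k heavier))

  coeffs-divisible : ∀ i j → (+ m) ∣ coeff K i j
  coeffs-divisible i j = divisible-above (13 ℕ.* N) i j (ℕP.m≤n+m _ (rank i j))

φ-independent : ∀ {m G Z} → LaurentAlg.eval G φ₁ φ₂ LaurentAlg.≈ LaurentAlg.eval Z φ₁ φ₂ [mod m ] →
                G PolyAlg.≈ Z [mod m ]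
φ-independent {m} {G} {Z} evals≈ = PolyAlg.mk≈mod λ i j → mk≡mod
  (subst ((+ m) ∣_) (PolyAlg.coeff-⊟ G Z i j) (Independence.coeffs-divisible (Poly._⊟_ G Z) pairing-divisible i j))
  where
    pairing-divisible : ∀ x y → (+ m) ∣ ⟪ Poly._⊟_ G Z , φ-table x y ⟫
    pairing-divisible x y = subst ((+ m) ∣_)
      (sym (trans (pairing-⊟ G Z (φ-table x y))
                  (sym (cong₂ _-_ (LaurentAlg.coeff-eval G φ₁ φ₂ x y) (LaurentAlg.coeff-eval Z φ₁ φ₂ x y)))))
      (difference-divisible (LaurentAlg.coeff-≡-mod evals≈ x y))

congruent-if-dilates : ∀ {p} → Prime p → ∀ n {G Z φ} → UnitCoefficients φ →
                       LaurentAlg.eval Z φ₁ φ₂ LaurentAlg.≐ LaurentAlg.pow φ (p ^ n) →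
                       LaurentAlg.eval G φ₁ φ₂ LaurentAlg.≐ dilate (p ^ n) φ →
                       G PolyAlg.≈ Z [mod p ]
congruent-if-dilates pr n φ-unit Z-evaluates G-evaluates = φ-independent
  (≈-mod-trans (≐⇒≈-mod G-evaluates) (≈-mod-trans (≈-mod-sym (pow-frobenius-dilate pr n _ φ-unit))
                                                  (≐⇒≈-mod (λ a b → sym (Z-evaluates a b)))))
  where open LaurentAlg using (≈-mod-trans; ≈-mod-sym; ≐⇒≈-mod)

φ₁-unit : UnitCoefficients φ₁
φ₁-unit = refl ∷ refl ∷ refl ∷ refl ∷ refl ∷ refl ∷ []

φ₂-unit : UnitCoefficients φ₂
φ₂-unit = refl ∷ refl ∷ refl ∷ refl ∷ refl ∷ refl ∷ []

module _ {p} (pr : Prime p) (n : ℕ) where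
  open PolyAlg

  IsG⇒congruent : ∀ {G₁ G₂} → IsG (p ^ n) G₁ G₂ →
                  G₁ ≈ pow X (p ^ n) [mod p ] × G₂ ≈ pow Y (p ^ n) [mod p ]
  IsG⇒congruent (G₁-dilates , G₂-dilates) =
      congruent-if-dilates pr n φ₁-unit (LaurentAlg.eval-X^ (p ^ n) φ₁ φ₂) G₁-dilates
    , congruent-if-dilates pr n φ₂-unit (LaurentAlg.eval-Y^ (p ^ n) φ₁ φ₂) G₂-dilates

  tilde-congruent : ∀ {G₁ G₂} → G₁ ≈ pow X (p ^ n) [mod p ] → G₂ ≈ pow Y (p ^ n) [mod p ] →
                    tilde₁ G₁ G₂ ≈ pow X (p ^ n) [mod p ] × tilde₂ G₁ G₂ ≈ pow Y (p ^ n) [mod p ]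
  tilde-congruent {G₁} {G₂} G₁≈X^q G₂≈Y^q = tilde₁≈X^q , tilde₂≈Y^q
    where
      open import Relation.Binary.Reasoning.Setoid (CommutativeSemiring.setoid (commutativeSemiring-mod p))
      q = p ^ n
      X+Y = X ⊞ Y

      tilde₁≈X^q : eval G₁ X X+Y ≈ pow X q [mod p ]
      tilde₁≈X^q = ≈-mod-trans (eval-congˡ-mod X X+Y G₁≈X^q) (≐⇒≈-mod (eval-X^ q X X+Y))

      tilde₂≈Y^q : eval G₂ X X+Y ⊟ eval G₁ X X+Y ≈ pow Y q [mod p ]
      tilde₂≈Y^q = begin
        eval G₂ X X+Y ⊟ eval G₁ X X+Y ≈⟨ ⊟-cong-mod (≈-mod-trans (eval-congˡ-mod X X+Y G₂≈Y^q)
                                                                 (≐⇒≈-mod (eval-Y^ q X X+Y)))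
                                                    tilde₁≈X^q ⟩
        pow X+Y q ⊟ pow X q           ≈⟨ ⊟-cong-mod (pow-⊞-frobenius pr n X Y) ≈-mod-refl ⟩
        (pow X q ⊞ pow Y q) ⊟ pow X q ≈⟨ ≐⇒≈-mod (P⊞Q⊟P≐Q (pow X q) (pow Y q)) ⟩
        pow Y q                       ∎

lemma3p2 : (p : ℕ) → Prime p → (n : ℕ) → (G₁ G₂ : Poly) → IsG (p ^ n) G₁ G₂ →
    (CongMod p (tilde₁ G₁ G₂) (Poly.pow X (p ^ n)) × CongMod p (tilde₂ G₁ G₂) (Poly.pow Y (p ^ n)))
    × (CongMod p G₁ (Poly.pow X (p ^ n)) × CongMod p G₂ (Poly.pow Y (p ^ n)))
lemma3p2 p pr n G₁ G₂ isG =
  let (G₁≈X^q , G₂≈Y^q)         = IsG⇒congruent pr n {G₁} {G₂} isG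
      (tilde₁≈X^q , tilde₂≈Y^q) = tilde-congruent pr n G₁≈X^q G₂≈Y^q
  in (≈⇒CongMod tilde₁≈X^q , ≈⇒CongMod tilde₂≈Y^q) , (≈⇒CongMod G₁≈X^q , ≈⇒CongMod G₂≈Y^q)
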